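{- Let $T$ be a rooted binary tree with leaves $v_1,\dots,v_n$, let $\gamma>0$ be small enough that $(1-2\gamma)^8>\max(\gamma^2,\gamma^4,\gamma^8)$ (e.g. $\gamma\le\frac1{16}$), let $\phi$ be the mapping $\phi_{T,\gamma}$ defined below, and write $x_i=\phi(v_i)$. For distinct leaves $v_i,v_j,v_k,v_l$ consider the polynomial \[ p(x_i,x_j,x_k,x_l)=\big((x_i-x_k)(x_i-x_l)(x_j-x_k)(x_j-x_l)\big)^2-\big((x_i-x_j)(x_k-x_l)\big)^4. \] Then: (1) if the quartet constraint $v_iv_j|v_kv_l$ is satisfied in $T$, then $p(x_i,x_j,x_k,x_l)>0$; (2) if $v_iv_j|v_kv_l$ is not satisfied in $T$, then $p(x_i,x_j,x_k,x_l)<0$.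
   Context: A rooted binary tree is a rooted tree in which every internal vertex has exactly two children (left and right). The quartet $v_iv_j|v_kv_l$ is satisfied in $T$ if the path between $v_i$ and $v_j$ is vertex-disjoint from the path between $v_k$ and $v_l$. The mapping $\phi_{T,\gamma}$ (for $0<\gamma<\frac12$) from the leaves of $T$ to $[0,1]$ is defined recursively by applying the following procedure to the interval $[0,1]$ and the tree $T$: given an interval $[a,b]$ and a rooted binary tree, if the tree has a single node, map that node to $\frac{a+b}{2}$; otherwise recursively map the leaves of the left subtree of the root into $[a,a+\gamma(b-a)]$ and the leaves of the right subtree into $[b-\gamma(b-a),b]$. This mapping satisfies $(1-2\gamma)\gamma^{\lambda}\le|\phi(v)-\phi(w)|\le\gamma^{\lambda}$ for distinct leaves $v,w$ whose lowest common ancestor has depth $\lambda$ (root depth $0$).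
   Formalization: The parameter γ ranges over the rationals, so the points $x_i=\phi(v_i)$ are rational as well. -}

module Defs where

open import Data.Nat using (ℕ; zero; suc)
open import Data.Rational using (ℚ; _+_; _*_; _-_; ½; 1ℚ; _<_)
open import Data.Product using (_×_)
open import Data.Sum using (_⊎_)
open import Data.Empty using (⊥)

data Tree : Set where
  leaf : Tree
  node : Tree → Tree → Tree

data Vertex : Tree → Set where
  root : ∀ {t} → Vertex t
  goL  : ∀ {l r} → Vertex l → Vertex (node l r)
  goR  : ∀ {l r} → Vertex r → Vertex (node l r)

data Leaf : Tree → Set where
  here : Leaf leaf
  inL  : ∀ {l r} → Leaf l → Leaf (node l r)
  inR  : ∀ {l r} → Leaf r → Leaf (node l r)

leafVertex : ∀ {t} → Leaf t → Vertex t
leafVertex here    = root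
leafVertex (inL x) = goL (leafVertex x)
leafVertex (inR x) = goR (leafVertex x)

data _≼_ : ∀ {t} → Vertex t → Vertex t → Set where
  root≼ : ∀ {t} {v : Vertex t} → root ≼ v
  goL≼  : ∀ {l r} {u v : Vertex l} → u ≼ v → goL {l} {r} u ≼ goL v
  goR≼  : ∀ {l r} {u v : Vertex r} → u ≼ v → goR {l} {r} u ≼ goR v

lca : ∀ {t} → Vertex t → Vertex t → Vertex t
lca (goL u) (goL v) = goL (lca u v)
lca (goR u) (goR v) = goR (lca u v)
lca _ _ = root

OnPath : ∀ {t} → Vertex t → Vertex t → Vertex t → Set
OnPath u v w = (w ≼ u ⊎ w ≼ v) × (lca u v ≼ w)

QuartetSatisfied : ∀ {t} → Leaf t → Leaf t → Leaf t → Leaf t → Set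
QuartetSatisfied {t} i j k l =
  (w : Vertex t) → OnPath (leafVertex i) (leafVertex j) w
                 → OnPath (leafVertex k) (leafVertex l) w → ⊥

φ-on : (γ a b : ℚ) → (t : Tree) → Leaf t → ℚ
φ-on γ a b leaf here = (a + b) * ½
φ-on γ a b (node l r) (inL x) = φ-on γ a (a + γ * (b - a)) l x
φ-on γ a b (node l r) (inR x) = φ-on γ (b - γ * (b - a)) b r x

φ : (γ : ℚ) → (t : Tree) → Leaf t → ℚ
φ γ t = φ-on γ (Data.Rational.0ℚ) 1ℚ t

_^_ : ℚ → ℕ → ℚ
x ^ zero  = 1ℚ
x ^ suc n = x * (x ^ n)

poly : ℚ → ℚ → ℚ → ℚ → ℚ
poly xi xj xk xl =
  (((xi - xk) * (xi - xl)) * ((xj - xk) * (xj - xl))) ^ 2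
  - ((xi - xj) * (xk - xl)) ^ 4

{-# OPTIONS --safe #-}

-- Under φ, the leaves below a vertex whose interval has width w lie in that interval, and those
-- of its two subtrees lie in the two end subintervals of width γw.  Hence two leaves whose lowest
-- common ancestor is that vertex are at distance between (1 - 2γ)w and w, while two leaves of the
-- same subtree are at distance at most γw.  In terms of squared distances d,
-- p = d_ik d_il d_jk d_jl - (d_ij d_kl)².  Follow i, j, k, l down the tree to the vertex where
-- they first split up.  If ij|kl holds, d_ij and d_kl are small compared to the cross distances
-- and p > 0 because γ⁴ < (1 - 2γ)⁸; otherwise some cross pair, say ik, is the close one and
-- p < 0 because γ² < (1 - 2γ)⁸.  When three leaves split off from the fourth, which pair of the
-- three is close is decided further down, by the same recursion for rooted triplets.

module Submission where

open import Defs
open import Data.Empty using (⊥)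
open import Data.List using (_∷_; [])
open import Data.Maybe using (Maybe; just; nothing)
open import Data.Product using (_×_; ∃-syntax; _,_; proj₁; proj₂)
open import Data.Rational
  using (ℚ; 0ℚ; 1ℚ; ½; _<_; _≤_; _+_; _-_; -_; _*_; _⊔_; positive; nonNegative; nonPositive)
open import Data.Rational.Properties
  using ( _≟_; +-*-commutativeRing; module ≤-Reasoning
        ; ≤-trans; <⇒≤; <-trans; ≤-<-trans; ≤-total; p≤p⊔q; p≤q⊔p
        ; +-mono-≤; +-mono-<; +-monoˡ-≤; +-monoˡ-<; +-monoʳ-<; neg-antimono-≤; +-inverseʳ; +-identityʳ
        ; *-monoˡ-≤-nonNeg; *-monoʳ-≤-nonNeg; *-monoˡ-<-pos
        ; pos*pos⇒pos; nonNeg*nonNeg⇒nonNeg; nonPos*nonPos⇒nonPos; positive⁻¹; nonNegative⁻¹ )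
open import Data.Rational.Solver using (module +-*-Solver)
open import Data.Sum using (inj₁; inj₂) renaming (map to ⊎-map; swap to ⊎-swap)
open import Function using (_∘_)
open import Function.Bundles using (_⇔_; mk⇔; Equivalence)
open import Level using (0ℓ)
open import Relation.Binary.PropositionalEquality using (_≡_; _≢_; refl; sym; cong; subst; subst₂)
open import Relation.Nullary using (¬_; yes; no; contradiction)
open import Tactic.RingSolver using (solve)
open import Tactic.RingSolver.Core.AlmostCommutativeRing using (AlmostCommutativeRing; fromCommutativeRing)

ℚ-ring : AlmostCommutativeRing 0ℓ 0ℓ
ℚ-ring = fromCommutativeRing +-*-commutativeRing isZero
  where
  isZero : ∀ x → Maybe (0ℚ ≡ x)
  isZero x with 0ℚ ≟ x
  ... | yes 0≡x = just 0≡x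
  ... | no _    = nothing

-- The reflective solver cannot parse poly or Defs._^_, so identities involving them go through
-- the non-reflective one.
private
  open +-*-Solver using (Polynomial; _:-_; _:*_; _:^_; _:=_)

  :poly : ∀ {n} → Polynomial n → Polynomial n → Polynomial n → Polynomial n → Polynomial n
  :poly a b c d = (((a :- c) :* (a :- d)) :* ((b :- c) :* (b :- d))) :^ 2 :- ((a :- b) :* (c :- d)) :^ 4

  :sqDist : ∀ {n} → Polynomial n → Polynomial n → Polynomial n
  :sqDist a b = (a :- b) :* (a :- b)

*-pos : ∀ {x y} → 0ℚ < x → 0ℚ < y → 0ℚ < x * y
*-pos {x} {y} 0<x 0<y = positive⁻¹ (x * y) {{pos*pos⇒pos x {{positive 0<x}} y {{positive 0<y}}}}

*-nonNeg : ∀ {x y} → 0ℚ ≤ x → 0ℚ ≤ y → 0ℚ ≤ x * y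
*-nonNeg {x} {y} 0≤x 0≤y =
  nonNegative⁻¹ (x * y) {{nonNeg*nonNeg⇒nonNeg x {{nonNegative 0≤x}} y {{nonNegative 0≤y}}}}

square-nonNeg : ∀ x → 0ℚ ≤ x * x
square-nonNeg x with ≤-total 0ℚ x
... | inj₁ 0≤x = *-nonNeg 0≤x 0≤x
... | inj₂ x≤0 =
  nonNegative⁻¹ (x * x) {{nonPos*nonPos⇒nonPos x {{nonPositive x≤0}} x {{nonPositive x≤0}}}}

*-mono-≤-nonNeg : ∀ {x y u v} → 0ℚ ≤ x → 0ℚ ≤ u → x ≤ y → u ≤ v → x * u ≤ y * v
*-mono-≤-nonNeg {x} {y} {u} {v} 0≤x 0≤u x≤y u≤v =
  ≤-trans (*-monoʳ-≤-nonNeg u {{nonNegative 0≤u}} x≤y)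
          (*-monoˡ-≤-nonNeg y {{nonNegative (≤-trans 0≤x x≤y)}} u≤v)

square-mono : ∀ {x y} → 0ℚ ≤ x → x ≤ y → x * x ≤ y * y
square-mono 0≤x x≤y = *-mono-≤-nonNeg 0≤x 0≤x x≤y x≤y

p≤q⇒0≤q-p : ∀ {p q} → p ≤ q → 0ℚ ≤ q - p
p≤q⇒0≤q-p {p} {q} p≤q = subst (_≤ q - p) (+-inverseʳ p) (+-monoˡ-≤ (- p) p≤q)

p<q⇒0<q-p : ∀ {p q} → p < q → 0ℚ < q - p
p<q⇒0<q-p {p} {q} p<q = subst (_< q - p) (+-inverseʳ p) (+-monoˡ-< (- p) p<q)

0<q-p⇒p<q : ∀ {p q} → 0ℚ < q - p → p < q
0<q-p⇒p<q {p} {q} 0<q-p = begin-strict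
  p            ≡⟨ sym (+-identityʳ p) ⟩
  p + 0ℚ       <⟨ +-monoʳ-< p 0<q-p ⟩
  p + (q - p)  ≡⟨ solve (p ∷ q ∷ []) ℚ-ring ⟩
  q            ∎
  where open ≤-Reasoning

p<q⇒p-q<0 : ∀ {p q} → p < q → p - q < 0ℚ
p<q⇒p-q<0 {p} {q} p<q = subst (p - q <_) (+-inverseʳ q) (+-monoˡ-< (- q) p<q)

<-by-width : ∀ {p q d} → 0ℚ < d → q - p ≡ d → p < q
<-by-width 0<d q-p≡d = 0<q-p⇒p<q (subst (0ℚ <_) (sym q-p≡d) 0<d)

infix 4 _∈[_,_]
_∈[_,_] : ℚ → ℚ → ℚ → Set
x ∈[ p , q ] = p ≤ x × x ≤ q

sqDist : ℚ → ℚ → ℚ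
sqDist x y = (x - y) * (x - y)

sqDist-comm : ∀ x y → sqDist x y ≡ sqDist y x
sqDist-comm = +-*-Solver.solve 2 (λ x y → :sqDist x y := :sqDist y x) refl

sqDist-nonNeg : ∀ x y → 0ℚ ≤ sqDist x y
sqDist-nonNeg x y = square-nonNeg (x - y)

sqDist-≤-ordered : ∀ {p q x y} → y ≤ x → x ≤ q → p ≤ y → sqDist x y ≤ (q - p) * (q - p)
sqDist-≤-ordered y≤x x≤q p≤y = square-mono (p≤q⇒0≤q-p y≤x) (+-mono-≤ x≤q (neg-antimono-≤ p≤y))

sqDist-≤ : ∀ {p q x y} → x ∈[ p , q ] → y ∈[ p , q ] → sqDist x y ≤ (q - p) * (q - p)
sqDist-≤ {x = x} {y} (p≤x , x≤q) (p≤y , y≤q) with ≤-total x y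
... | inj₁ x≤y = subst (_≤ _) (sqDist-comm y x) (sqDist-≤-ordered x≤y y≤q p≤x)
... | inj₂ y≤x = sqDist-≤-ordered y≤x x≤q p≤y

sqDist-≥ : ∀ {p q x y} → x ≤ p → q ≤ y → p ≤ q → (q - p) * (q - p) ≤ sqDist x y
sqDist-≥ {x = x} {y} x≤p q≤y p≤q =
  subst (_ ≤_) (sqDist-comm y x) (square-mono (p≤q⇒0≤q-p p≤q) (+-mono-≤ q≤y (neg-antimono-≤ x≤p)))

Within : ℚ → ℚ → ℚ → Set
Within s x y = sqDist x y ≤ s * s

Near : ℚ → ℚ → ℚ → ℚ → Set
Near γ s x y = sqDist x y ≤ (γ * s) * (γ * s)

Far : ℚ → ℚ → ℚ → ℚ → Set
Far c s x y = (c * s) * (c * s) ≤ sqDist x y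

Apart : ℚ → ℚ → ℚ → ℚ → Set
Apart c s x y = Far c s x y × Within s x y

Within-comm : ∀ {s x y} → Within s x y → Within s y x
Within-comm {x = x} {y} = subst (_≤ _) (sqDist-comm x y)

Apart-comm : ∀ {c s x y} → Apart c s x y → Apart c s y x
Apart-comm {s = s} {x} {y} (far , within) =
  subst (_ ≤_) (sqDist-comm x y) far , Within-comm {s} {x} {y} within

poly-as-sqDist : ∀ xi xj xk xl → poly xi xj xk xl
  ≡ (sqDist xi xk * sqDist xi xl) * (sqDist xj xk * sqDist xj xl)
    - (sqDist xi xj * sqDist xk xl) * (sqDist xi xj * sqDist xk xl)
poly-as-sqDist = +-*-Solver.solve 4 (λ a b c d → :poly a b c d :=
  (:sqDist a c :* :sqDist a d) :* (:sqDist b c :* :sqDist b d)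
  :- (:sqDist a b :* :sqDist c d) :* (:sqDist a b :* :sqDist c d)) refl

poly-swap₁₂ : ∀ xi xj xk xl → poly xi xj xk xl ≡ poly xj xi xk xl
poly-swap₁₂ = +-*-Solver.solve 4 (λ a b c d → :poly a b c d := :poly b a c d) refl

poly-swap₃₄ : ∀ xi xj xk xl → poly xi xj xk xl ≡ poly xi xj xl xk
poly-swap₃₄ = +-*-Solver.solve 4 (λ a b c d → :poly a b c d := :poly a b d c) refl

poly-swap-pairs : ∀ xi xj xk xl → poly xi xj xk xl ≡ poly xk xl xi xj
poly-swap-pairs = +-*-Solver.solve 4 (λ a b c d → :poly a b c d := :poly c d a b) refl

^4-as-product : ∀ x → x ^ 4 ≡ (x * x) * (x * x)
^4-as-product = +-*-Solver.solve 1 (λ x → x :^ 4 := (x :* x) :* (x :* x)) refl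

^8-as-product : ∀ x → x ^ 8 ≡ ((x * x) * (x * x)) * ((x * x) * (x * x))
^8-as-product = +-*-Solver.solve 1 (λ x → x :^ 8 := ((x :* x) :* (x :* x)) :* ((x :* x) :* (x :* x))) refl

^2-as-product : ∀ x → x ^ 2 ≡ x * x
^2-as-product = +-*-Solver.solve 1 (λ x → x :^ 2 := x :* x) refl

0<[uw]⁴ : ∀ {u w} → 0ℚ < u → 0ℚ < w → 0ℚ < ((u * w) * (u * w)) * ((u * w) * (u * w))
0<[uw]⁴ 0<u 0<w = let 0<uw = *-pos 0<u 0<w in *-pos (*-pos 0<uw 0<uw) (*-pos 0<uw 0<uw)

module PolySign (γ c : ℚ) where

  poly-pos : ∀ {u w} xi xj xk xl → γ ^ 4 < c ^ 8 → 0ℚ < u → 0ℚ < w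
           → Near γ u xi xj → Within w xk xl
           → Far c u xi xk → Far c w xi xl → Far c u xj xk → Far c w xj xl
           → 0ℚ < poly xi xj xk xl
  poly-pos {u} {w} xi xj xk xl γ⁴<c⁸ 0<u 0<w ij kl ik il jk jl =
    subst (0ℚ <_) (sym (poly-as-sqDist xi xj xk xl)) (p<q⇒0<q-p pairs²<cross)
    where
    open ≤-Reasoning
    0≤b : 0ℚ ≤ ((c * u) * (c * u)) * ((c * w) * (c * w))
    0≤b = *-nonNeg (square-nonNeg (c * u)) (square-nonNeg (c * w))
    pairs²<cross : (sqDist xi xj * sqDist xk xl) * (sqDist xi xj * sqDist xk xl)
                 < (sqDist xi xk * sqDist xi xl) * (sqDist xj xk * sqDist xj xl)
    pairs²<cross = begin-strict
        (sqDist xi xj * sqDist xk xl) * (sqDist xi xj * sqDist xk xl)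
      ≤⟨ square-mono (*-nonNeg (sqDist-nonNeg xi xj) (sqDist-nonNeg xk xl))
                     (*-mono-≤-nonNeg (sqDist-nonNeg xi xj) (sqDist-nonNeg xk xl) ij kl) ⟩
        (((γ * u) * (γ * u)) * (w * w)) * (((γ * u) * (γ * u)) * (w * w))
      ≡⟨ solve (γ ∷ u ∷ w ∷ []) ℚ-ring ⟩
        ((γ * γ) * (γ * γ)) * (((u * w) * (u * w)) * ((u * w) * (u * w)))
      <⟨ *-monoˡ-<-pos _ {{positive (0<[uw]⁴ 0<u 0<w)}}
                        (subst₂ _<_ (^4-as-product γ) (^8-as-product c) γ⁴<c⁸) ⟩
        (((c * c) * (c * c)) * ((c * c) * (c * c))) * (((u * w) * (u * w)) * ((u * w) * (u * w)))
      ≡⟨ solve (c ∷ u ∷ w ∷ []) ℚ-ring ⟩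
        (((c * u) * (c * u)) * ((c * w) * (c * w))) * (((c * u) * (c * u)) * ((c * w) * (c * w)))
      ≤⟨ *-mono-≤-nonNeg 0≤b 0≤b
           (*-mono-≤-nonNeg (square-nonNeg (c * u)) (square-nonNeg (c * w)) ik il)
           (*-mono-≤-nonNeg (square-nonNeg (c * u)) (square-nonNeg (c * w)) jk jl) ⟩
        (sqDist xi xk * sqDist xi xl) * (sqDist xj xk * sqDist xj xl)
      ∎

  poly-neg : ∀ {u w} xi xj xk xl → γ ^ 2 < c ^ 8 → 0ℚ < u → 0ℚ < w
           → Near γ u xi xk → Within w xi xl → Within u xk xj → Within w xj xl
           → Far c u xi xj → Far c w xk xl
           → poly xi xj xk xl < 0ℚ
  poly-neg {u} {w} xi xj xk xl γ²<c⁸ 0<u 0<w ik il kj jl ij kl =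
    subst (_< 0ℚ) (sym (poly-as-sqDist xi xj xk xl)) (p<q⇒p-q<0 cross<pairs²)
    where
    open ≤-Reasoning
    cross<pairs² : (sqDist xi xk * sqDist xi xl) * (sqDist xj xk * sqDist xj xl)
                 < (sqDist xi xj * sqDist xk xl) * (sqDist xi xj * sqDist xk xl)
    cross<pairs² = begin-strict
        (sqDist xi xk * sqDist xi xl) * (sqDist xj xk * sqDist xj xl)
      ≤⟨ *-mono-≤-nonNeg (*-nonNeg (sqDist-nonNeg xi xk) (sqDist-nonNeg xi xl))
                         (*-nonNeg (sqDist-nonNeg xj xk) (sqDist-nonNeg xj xl))
           (*-mono-≤-nonNeg (sqDist-nonNeg xi xk) (sqDist-nonNeg xi xl) ik il)
           (*-mono-≤-nonNeg (sqDist-nonNeg xj xk) (sqDist-nonNeg xj xl)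
                            (Within-comm {u} {xk} {xj} kj) jl) ⟩
        (((γ * u) * (γ * u)) * (w * w)) * ((u * u) * (w * w))
      ≡⟨ solve (γ ∷ u ∷ w ∷ []) ℚ-ring ⟩
        (γ * γ) * (((u * w) * (u * w)) * ((u * w) * (u * w)))
      <⟨ *-monoˡ-<-pos _ {{positive (0<[uw]⁴ 0<u 0<w)}}
                        (subst₂ _<_ (^2-as-product γ) (^8-as-product c) γ²<c⁸) ⟩
        (((c * c) * (c * c)) * ((c * c) * (c * c))) * (((u * w) * (u * w)) * ((u * w) * (u * w)))
      ≡⟨ solve (c ∷ u ∷ w ∷ []) ℚ-ring ⟩
        (((c * u) * (c * u)) * ((c * w) * (c * w))) * (((c * u) * (c * u)) * ((c * w) * (c * w)))
      ≤⟨ square-mono (*-nonNeg (square-nonNeg (c * u)) (square-nonNeg (c * w)))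
           (*-mono-≤-nonNeg (square-nonNeg (c * u)) (square-nonNeg (c * w)) ij kl) ⟩
        (sqDist xi xj * sqDist xk xl) * (sqDist xi xj * sqDist xk xl)
      ∎

SignedBy : ℚ → Set → Set
SignedBy p Q = (Q → 0ℚ < p) × (¬ Q → p < 0ℚ)

signed-pos : ∀ {p Q} → Q → 0ℚ < p → SignedBy p Q
signed-pos q 0<p = (λ _ → 0<p) , (λ ¬q → contradiction q ¬q)

signed-neg : ∀ {p Q} → ¬ Q → p < 0ℚ → SignedBy p Q
signed-neg ¬q p<0 = (λ q → contradiction q ¬q) , (λ _ → p<0)

signed-resp : ∀ {p p′ Q Q′} → p ≡ p′ → Q ⇔ Q′ → SignedBy p Q → SignedBy p′ Q′
signed-resp refl Q⇔Q′ (pos , neg) =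
  pos ∘ Equivalence.from Q⇔Q′ , λ ¬q′ → neg (¬q′ ∘ Equivalence.to Q⇔Q′)

lca-comm : ∀ {t} (u v : Vertex t) → lca u v ≡ lca v u
lca-comm root    root    = refl
lca-comm root    (goL _) = refl
lca-comm root    (goR _) = refl
lca-comm (goL _) root    = refl
lca-comm (goL u) (goL v) = cong goL (lca-comm u v)
lca-comm (goL _) (goR _) = refl
lca-comm (goR _) root    = refl
lca-comm (goR _) (goL _) = refl
lca-comm (goR u) (goR v) = cong goR (lca-comm u v)

OnPath-comm : ∀ {t} {u v w : Vertex t} → OnPath u v w → OnPath v u w
OnPath-comm {u = u} {v} (w≼u⊎v , lca≼w) = ⊎-swap w≼u⊎v , subst (_≼ _) (lca-comm u v) lca≼w

root-OnPath : ∀ {t} {u v : Vertex t} → lca u v ≡ root → OnPath u v root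
root-OnPath lca≡root = inj₁ root≼ , subst (_≼ root) (sym lca≡root) root≼

goL≼⁻ : ∀ {l r} {u v : Vertex l} → goL {r = r} u ≼ goL v → u ≼ v
goL≼⁻ (goL≼ u≼v) = u≼v

goR≼⁻ : ∀ {l r} {u v : Vertex r} → goR {l = l} u ≼ goR v → u ≼ v
goR≼⁻ (goR≼ u≼v) = u≼v

OnPath-goL : ∀ {l r} {u v w : Vertex l} → OnPath u v w → OnPath (goL {r = r} u) (goL v) (goL w)
OnPath-goL (w≼u⊎v , lca≼w) = ⊎-map goL≼ goL≼ w≼u⊎v , goL≼ lca≼w

OnPath-goL⁻ : ∀ {l r} {u v w : Vertex l} → OnPath (goL {r = r} u) (goL v) (goL w) → OnPath u v w
OnPath-goL⁻ (w≼u⊎v , lca≼w) = ⊎-map goL≼⁻ goL≼⁻ w≼u⊎v , goL≼⁻ lca≼w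

OnPath-goR : ∀ {l r} {u v w : Vertex r} → OnPath u v w → OnPath (goR {l = l} u) (goR v) (goR w)
OnPath-goR (w≼u⊎v , lca≼w) = ⊎-map goR≼ goR≼ w≼u⊎v , goR≼ lca≼w

OnPath-goR⁻ : ∀ {l r} {u v w : Vertex r} → OnPath (goR {l = l} u) (goR v) (goR w) → OnPath u v w
OnPath-goR⁻ (w≼u⊎v , lca≼w) = ⊎-map goR≼⁻ goR≼⁻ w≼u⊎v , goR≼⁻ lca≼w

-- The rooted triplet pq|r: the quartet condition for p, q | r, root.
TripletSatisfied : ∀ {t} → Leaf t → Leaf t → Leaf t → Set
TripletSatisfied {t} p q r =
  (w : Vertex t) → OnPath (leafVertex p) (leafVertex q) w → w ≼ leafVertex r → ⊥

¬triplet-across : ∀ {t} {p q r : Leaf t} → lca (leafVertex p) (leafVertex q) ≡ root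
                → ¬ TripletSatisfied p q r
¬triplet-across lca≡root pq|r = pq|r root (root-OnPath lca≡root) root≼

triplet-inL : ∀ {L R} {p q r : Leaf L}
            → TripletSatisfied p q r ⇔ TripletSatisfied {node L R} (inL p) (inL q) (inL r)
triplet-inL {L} {R} {p} {q} {r} = mk⇔ lift lower
  where
  lift : TripletSatisfied p q r → TripletSatisfied {node L R} (inL p) (inL q) (inL r)
  lift pq|r root    (_ , ())
  lift pq|r (goL w) path (goL≼ w≼r) = pq|r w (OnPath-goL⁻ path) w≼r
  lift pq|r (goR w) (_ , ())
  lower : TripletSatisfied {node L R} (inL p) (inL q) (inL r) → TripletSatisfied p q r
  lower pq|r w path w≼r = pq|r (goL w) (OnPath-goL path) (goL≼ w≼r)

triplet-inR : ∀ {L R} {p q r : Leaf R}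
            → TripletSatisfied p q r ⇔ TripletSatisfied {node L R} (inR p) (inR q) (inR r)
triplet-inR {L} {R} {p} {q} {r} = mk⇔ lift lower
  where
  lift : TripletSatisfied p q r → TripletSatisfied {node L R} (inR p) (inR q) (inR r)
  lift pq|r root    (_ , ())
  lift pq|r (goL w) (_ , ())
  lift pq|r (goR w) path (goR≼ w≼r) = pq|r w (OnPath-goR⁻ path) w≼r
  lower : TripletSatisfied {node L R} (inR p) (inR q) (inR r) → TripletSatisfied p q r
  lower pq|r w path w≼r = pq|r (goR w) (OnPath-goR path) (goR≼ w≼r)

triplet-LLR : ∀ {L R} {p q : Leaf L} {r : Leaf R}
            → TripletSatisfied {node L R} (inL p) (inL q) (inR r)
triplet-LLR root    (_ , ())
triplet-LLR (goL w) _ ()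
triplet-LLR (goR w) (_ , ())

triplet-RRL : ∀ {L R} {p q : Leaf R} {r : Leaf L}
            → TripletSatisfied {node L R} (inR p) (inR q) (inL r)
triplet-RRL root    (_ , ())
triplet-RRL (goL w) (_ , ())
triplet-RRL (goR w) _ ()

¬quartet-across : ∀ {t} {i j k l : Leaf t}
                → lca (leafVertex i) (leafVertex j) ≡ root → lca (leafVertex k) (leafVertex l) ≡ root
                → ¬ QuartetSatisfied i j k l
¬quartet-across ij≡root kl≡root ij|kl = ij|kl root (root-OnPath ij≡root) (root-OnPath kl≡root)

quartet-swap₁₂ : ∀ {t} {i j k l : Leaf t} → QuartetSatisfied i j k l ⇔ QuartetSatisfied j i k l
quartet-swap₁₂ = mk⇔ (λ ij|kl w ji → ij|kl w (OnPath-comm ji))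
                     (λ ji|kl w ij → ji|kl w (OnPath-comm ij))

quartet-swap₃₄ : ∀ {t} {i j k l : Leaf t} → QuartetSatisfied i j k l ⇔ QuartetSatisfied i j l k
quartet-swap₃₄ = mk⇔ (λ ij|kl w ij lk → ij|kl w ij (OnPath-comm lk))
                     (λ ij|lk w ij kl → ij|lk w ij (OnPath-comm kl))

quartet-swap-pairs : ∀ {t} {i j k l : Leaf t} → QuartetSatisfied i j k l ⇔ QuartetSatisfied k l i j
quartet-swap-pairs = mk⇔ (λ ij|kl w kl ij → ij|kl w ij kl) (λ kl|ij w ij kl → kl|ij w kl ij)

quartet-inL : ∀ {L R} {i j k l : Leaf L}
            → QuartetSatisfied i j k l ⇔ QuartetSatisfied {node L R} (inL i) (inL j) (inL k) (inL l)
quartet-inL {L} {R} {i} {j} {k} {l} = mk⇔ lift lower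
  where
  lift : QuartetSatisfied i j k l → QuartetSatisfied {node L R} (inL i) (inL j) (inL k) (inL l)
  lift ij|kl root    (_ , ())
  lift ij|kl (goL w) ij kl = ij|kl w (OnPath-goL⁻ ij) (OnPath-goL⁻ kl)
  lift ij|kl (goR w) (_ , ())
  lower : QuartetSatisfied {node L R} (inL i) (inL j) (inL k) (inL l) → QuartetSatisfied i j k l
  lower ij|kl w ij kl = ij|kl (goL w) (OnPath-goL ij) (OnPath-goL kl)

quartet-inR : ∀ {L R} {i j k l : Leaf R}
            → QuartetSatisfied i j k l ⇔ QuartetSatisfied {node L R} (inR i) (inR j) (inR k) (inR l)
quartet-inR {L} {R} {i} {j} {k} {l} = mk⇔ lift lower
  where
  lift : QuartetSatisfied i j k l → QuartetSatisfied {node L R} (inR i) (inR j) (inR k) (inR l)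
  lift ij|kl root    (_ , ())
  lift ij|kl (goL w) (_ , ())
  lift ij|kl (goR w) ij kl = ij|kl w (OnPath-goR⁻ ij) (OnPath-goR⁻ kl)
  lower : QuartetSatisfied {node L R} (inR i) (inR j) (inR k) (inR l) → QuartetSatisfied i j k l
  lower ij|kl w ij kl = ij|kl (goR w) (OnPath-goR ij) (OnPath-goR kl)

quartet-LLRR : ∀ {L R} {i j : Leaf L} {k l : Leaf R}
             → QuartetSatisfied {node L R} (inL i) (inL j) (inR k) (inR l)
quartet-LLRR root    (_ , ())
quartet-LLRR (goL w) _ (_ , ())
quartet-LLRR (goR w) (_ , ())

quartet-LLLR⇔triplet : ∀ {L R} {i j k : Leaf L} {l : Leaf R}
                     → QuartetSatisfied {node L R} (inL i) (inL j) (inL k) (inR l) ⇔ TripletSatisfied i j k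
quartet-LLLR⇔triplet {L} {R} {i} {j} {k} {l} = mk⇔ to from
  where
  to : QuartetSatisfied {node L R} (inL i) (inL j) (inL k) (inR l) → TripletSatisfied i j k
  to ij|kl w ij w≼k = ij|kl (goL w) (OnPath-goL ij) (inj₁ (goL≼ w≼k) , root≼)
  from : TripletSatisfied i j k → QuartetSatisfied {node L R} (inL i) (inL j) (inL k) (inR l)
  from ij|k root    (_ , ())
  from ij|k (goL w) ij (inj₁ (goL≼ w≼k) , _) = ij|k w (OnPath-goL⁻ ij) w≼k
  from ij|k (goL w) _  (inj₂ () , _)
  from ij|k (goR w) (_ , ())

quartet-RRRL⇔triplet : ∀ {L R} {i j k : Leaf R} {l : Leaf L}
                     → QuartetSatisfied {node L R} (inR i) (inR j) (inR k) (inL l) ⇔ TripletSatisfied i j k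
quartet-RRRL⇔triplet {L} {R} {i} {j} {k} {l} = mk⇔ to from
  where
  to : QuartetSatisfied {node L R} (inR i) (inR j) (inR k) (inL l) → TripletSatisfied i j k
  to ij|kl w ij w≼k = ij|kl (goR w) (OnPath-goR ij) (inj₁ (goR≼ w≼k) , root≼)
  from : TripletSatisfied i j k → QuartetSatisfied {node L R} (inR i) (inR j) (inR k) (inL l)
  from ij|k root    (_ , ())
  from ij|k (goL w) (_ , ())
  from ij|k (goR w) ij (inj₁ (goR≼ w≼k) , _) = ij|k w (OnPath-goR⁻ ij) w≼k
  from ij|k (goR w) _  (inj₂ () , _)

module _ (γ : ℚ) (0<γ : 0ℚ < γ) (γ<½ : γ < ½) where

  private
    c : ℚ
    c = 1ℚ - (γ + γ)

    0<c : 0ℚ < c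
    0<c = p<q⇒0<q-p (+-mono-< γ<½ γ<½)

    -- The reflective ring solver only sees through inlined definitions; for the same reason
    -- gap-width spells out c.
    leftEnd rightStart : ℚ → ℚ → ℚ
    leftEnd a b = a + γ * (b - a)
    rightStart a b = b - γ * (b - a)
    {-# INLINE leftEnd #-}
    {-# INLINE rightStart #-}

    left-width : ∀ a b → leftEnd a b - a ≡ γ * (b - a)
    left-width a b = solve (a ∷ b ∷ γ ∷ []) ℚ-ring

    gap-width : ∀ a b → rightStart a b - leftEnd a b ≡ (1ℚ - (γ + γ)) * (b - a)
    gap-width a b = solve (a ∷ b ∷ γ ∷ []) ℚ-ring

    right-width : ∀ a b → b - rightStart a b ≡ γ * (b - a)
    right-width a b = solve (a ∷ b ∷ γ ∷ []) ℚ-ring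

    a<leftEnd : ∀ {a b} → a < b → a < leftEnd a b
    a<leftEnd {a} {b} a<b = <-by-width (*-pos 0<γ (p<q⇒0<q-p a<b)) (left-width a b)

    leftEnd<rightStart : ∀ {a b} → a < b → leftEnd a b < rightStart a b
    leftEnd<rightStart {a} {b} a<b = <-by-width (*-pos 0<c (p<q⇒0<q-p a<b)) (gap-width a b)

    rightStart<b : ∀ {a b} → a < b → rightStart a b < b
    rightStart<b {a} {b} a<b = <-by-width (*-pos 0<γ (p<q⇒0<q-p a<b)) (right-width a b)

    midpoint-∈ : ∀ {a b} → a < b → (a + b) * ½ ∈[ a , b ]
    midpoint-∈ {a} {b} a<b = <⇒≤ (<-by-width 0<half-width (solve (a ∷ b ∷ []) ℚ-ring))
                           , <⇒≤ (<-by-width 0<half-width (solve (a ∷ b ∷ []) ℚ-ring))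
      where
      0<half-width : 0ℚ < (b - a) * ½
      0<half-width = *-pos (p<q⇒0<q-p a<b) (positive⁻¹ ½)

  φ-on-∈ : ∀ t {a b} → a < b → (x : Leaf t) → φ-on γ a b t x ∈[ a , b ]
  φ-on-∈ leaf a<b here = midpoint-∈ a<b
  φ-on-∈ (node L R) a<b (inL x) =
    let a≤φ , φ≤leftEnd = φ-on-∈ L (a<leftEnd a<b) x
    in a≤φ , ≤-trans φ≤leftEnd (<⇒≤ (<-trans (leftEnd<rightStart a<b) (rightStart<b a<b)))
  φ-on-∈ (node L R) a<b (inR x) =
    let rightStart≤φ , φ≤b = φ-on-∈ R (rightStart<b a<b) x
    in ≤-trans (<⇒≤ (<-trans (a<leftEnd a<b) (leftEnd<rightStart a<b))) rightStart≤φ , φ≤b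

  Cherry : ℚ → ℚ → ℚ → ℚ → Set
  Cherry u x y z = Near γ u x y × Apart c u x z × Apart c u y z

  data TripletShape (u x y z : ℚ) (T : Set) : Set where
    xy-close : T → Cherry u x y z → TripletShape u x y z T
    xz-close : ¬ T → Cherry u x z y → TripletShape u x y z T
    yz-close : ¬ T → Cherry u y z x → TripletShape u x y z T

  TripletShape-resp : ∀ {u x y z T T′} → T ⇔ T′ → TripletShape u x y z T → TripletShape u x y z T′
  TripletShape-resp T⇔T′ (xy-close t cherry)  = xy-close (Equivalence.to T⇔T′ t) cherry
  TripletShape-resp T⇔T′ (xz-close ¬t cherry) = xz-close (¬t ∘ Equivalence.from T⇔T′) cherry
  TripletShape-resp T⇔T′ (yz-close ¬t cherry) = yz-close (¬t ∘ Equivalence.from T⇔T′) cherry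

  TripletShaped : (t : Tree) → ℚ → ℚ → Leaf t → Leaf t → Leaf t → Set
  TripletShaped t a b p q r = let f = φ-on γ a b t in
    ∃[ u ] 0ℚ < u × TripletShape u (f p) (f q) (f r) (TripletSatisfied p q r)

  QuartetSigned : (t : Tree) → ℚ → ℚ → (i j k l : Leaf t) → Set
  QuartetSigned t a b i j k l = let f = φ-on γ a b t in
    SignedBy (poly (f i) (f j) (f k) (f l)) (QuartetSatisfied i j k l)

  QuartetSigned-swap₁₂ : ∀ {t a b} {i j k l : Leaf t}
                       → QuartetSigned t a b i j k l → QuartetSigned t a b j i k l
  QuartetSigned-swap₁₂ {t} {a} {b} {i} {j} {k} {l} = let f = φ-on γ a b t in
    signed-resp (poly-swap₁₂ (f i) (f j) (f k) (f l)) quartet-swap₁₂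

  QuartetSigned-swap₃₄ : ∀ {t a b} {i j k l : Leaf t}
                       → QuartetSigned t a b i j k l → QuartetSigned t a b i j l k
  QuartetSigned-swap₃₄ {t} {a} {b} {i} {j} {k} {l} = let f = φ-on γ a b t in
    signed-resp (poly-swap₃₄ (f i) (f j) (f k) (f l)) quartet-swap₃₄

  QuartetSigned-swap-pairs : ∀ {t a b} {i j k l : Leaf t}
                           → QuartetSigned t a b i j k l → QuartetSigned t a b k l i j
  QuartetSigned-swap-pairs {t} {a} {b} {i} {j} {k} {l} = let f = φ-on γ a b t in
    signed-resp (poly-swap-pairs (f i) (f j) (f k) (f l)) quartet-swap-pairs

  TripletsShaped : Tree → ℚ → ℚ → Set
  TripletsShaped t a b = (p q r : Leaf t) → p ≢ q → TripletShaped t a b p q r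

  QuartetsSigned : Tree → ℚ → ℚ → Set
  QuartetsSigned t a b = (i j k l : Leaf t) → i ≢ j → k ≢ l → QuartetSigned t a b i j k l

  module Node {L R : Tree} {a b : ℚ} (a<b : a < b) where

    f : Leaf (node L R) → ℚ
    f = φ-on γ a b (node L R)

    w : ℚ
    w = b - a

    private
      f∈left : (x : Leaf L) → f (inL x) ∈[ a , leftEnd a b ]
      f∈left = φ-on-∈ L (a<leftEnd a<b)

      f∈right : (x : Leaf R) → f (inR x) ∈[ rightStart a b , b ]
      f∈right = φ-on-∈ R (rightStart<b a<b)

    0<w : 0ℚ < w
    0<w = p<q⇒0<q-p a<b

    within : (x y : Leaf (node L R)) → Within w (f x) (f y)
    within x y = sqDist-≤ (φ-on-∈ (node L R) a<b x) (φ-on-∈ (node L R) a<b y)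

    near-LL : (x y : Leaf L) → Near γ w (f (inL x)) (f (inL y))
    near-LL x y = subst (λ d → sqDist (f (inL x)) (f (inL y)) ≤ d * d) (left-width a b)
                        (sqDist-≤ (f∈left x) (f∈left y))

    near-RR : (x y : Leaf R) → Near γ w (f (inR x)) (f (inR y))
    near-RR x y = subst (λ d → sqDist (f (inR x)) (f (inR y)) ≤ d * d) (right-width a b)
                        (sqDist-≤ (f∈right x) (f∈right y))

    apart-LR : (x : Leaf L) (y : Leaf R) → Apart c w (f (inL x)) (f (inR y))
    apart-LR x y = subst (λ d → d * d ≤ sqDist (f (inL x)) (f (inR y))) (gap-width a b)
                         (sqDist-≥ (proj₂ (f∈left x)) (proj₁ (f∈right y)) (<⇒≤ (leftEnd<rightStart a<b)))
                 , within (inL x) (inR y)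

    apart-RL : (x : Leaf R) (y : Leaf L) → Apart c w (f (inR x)) (f (inL y))
    apart-RL x y = Apart-comm {c} {w} {f (inL y)} {f (inR x)} (apart-LR y x)

    triplet-node : TripletsShaped L a (leftEnd a b) → TripletsShaped R (rightStart a b) b
                 → TripletsShaped (node L R) a b
    triplet-node shapedL _ (inL p) (inL q) (inL r) p≢q =
      let u , 0<u , shape = shapedL p q r (p≢q ∘ cong inL)
      in u , 0<u , TripletShape-resp triplet-inL shape
    triplet-node _ shapedR (inR p) (inR q) (inR r) p≢q =
      let u , 0<u , shape = shapedR p q r (p≢q ∘ cong inR)
      in u , 0<u , TripletShape-resp triplet-inR shape
    triplet-node _ _ (inL p) (inL q) (inR r) _ =
      w , 0<w , xy-close triplet-LLR (near-LL p q , apart-LR p r , apart-LR q r)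
    triplet-node _ _ (inR p) (inR q) (inL r) _ =
      w , 0<w , xy-close triplet-RRL (near-RR p q , apart-RL p r , apart-RL q r)
    triplet-node _ _ (inL p) (inR q) (inL r) _ =
      w , 0<w , xz-close (¬triplet-across refl) (near-LL p r , apart-LR p q , apart-LR r q)
    triplet-node _ _ (inR p) (inL q) (inR r) _ =
      w , 0<w , xz-close (¬triplet-across refl) (near-RR p r , apart-RL p q , apart-RL r q)
    triplet-node _ _ (inL p) (inR q) (inR r) _ =
      w , 0<w , yz-close (¬triplet-across refl) (near-RR q r , apart-RL q p , apart-RL r p)
    triplet-node _ _ (inR p) (inL q) (inL r) _ =
      w , 0<w , yz-close (¬triplet-across refl) (near-LL q r , apart-LR q p , apart-LR r p)

  triplets-shaped : ∀ t {a b} → a < b → TripletsShaped t a b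
  triplets-shaped leaf       _   here here _ here≢here = contradiction refl here≢here
  triplets-shaped (node L R) a<b =
    triplet-node (triplets-shaped L (a<leftEnd a<b)) (triplets-shaped R (rightStart<b a<b))
    where open Node a<b

  module _ (γ²<c⁸ : γ ^ 2 < c ^ 8) (γ⁴<c⁸ : γ ^ 4 < c ^ 8) where

    open PolySign γ c

    signed-3+1 : ∀ {w xi xj xk xl T Q}
               → (∃[ u ] 0ℚ < u × TripletShape u xi xj xk T) → 0ℚ < w
               → Apart c w xi xl → Apart c w xj xl → Apart c w xk xl → Q ⇔ T
               → SignedBy (poly xi xj xk xl) Q
    signed-3+1 {xi = xi} {xj} {xk} {xl} (u , 0<u , xy-close t (ij , (ik , _) , (jk , _)))
               0<w (il , _) (jl , _) (_ , kl) Q⇔T =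
      signed-pos (Equivalence.from Q⇔T t) (poly-pos xi xj xk xl γ⁴<c⁸ 0<u 0<w ij kl ik il jk jl)
    signed-3+1 {xi = xi} {xj} {xk} {xl} (u , 0<u , xz-close ¬t (ik , (ij , _) , (_ , kj)))
               0<w (_ , il) (_ , jl) (kl , _) Q⇔T =
      signed-neg (¬t ∘ Equivalence.to Q⇔T) (poly-neg xi xj xk xl γ²<c⁸ 0<u 0<w ik il kj jl ij kl)
    signed-3+1 {xi = xi} {xj} {xk} {xl} (u , 0<u , yz-close ¬t (jk , (ji , _) , (_ , ki)))
               0<w (_ , il) (_ , jl) (kl , _) Q⇔T =
      signed-neg (¬t ∘ Equivalence.to Q⇔T)
        (subst (_< 0ℚ) (poly-swap₁₂ xj xi xk xl)
               (poly-neg xj xi xk xl γ²<c⁸ 0<u 0<w jk jl ki il ji kl))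

    module NodeQuartets {L R : Tree} {a b : ℚ} (a<b : a < b) where
      open Node {L} {R} a<b

      split : (i j : Leaf L) (k l : Leaf R) → QuartetSigned (node L R) a b (inL i) (inL j) (inR k) (inR l)
      split i j k l = signed-pos quartet-LLRR
        (poly-pos (f (inL i)) (f (inL j)) (f (inR k)) (f (inR l)) γ⁴<c⁸ 0<w 0<w
                  (near-LL i j) (within (inR k) (inR l))
                  (proj₁ (apart-LR i k)) (proj₁ (apart-LR i l))
                  (proj₁ (apart-LR j k)) (proj₁ (apart-LR j l)))

      crossed : (i k : Leaf L) (j l : Leaf R) → QuartetSigned (node L R) a b (inL i) (inR j) (inL k) (inR l)
      crossed i k j l = signed-neg (¬quartet-across refl refl)
        (poly-neg (f (inL i)) (f (inR j)) (f (inL k)) (f (inR l)) γ²<c⁸ 0<w 0<w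
                  (near-LL i k) (within (inL i) (inR l)) (within (inL k) (inR j)) (within (inR j) (inR l))
                  (proj₁ (apart-LR i j)) (proj₁ (apart-LR k l)))

      outlier-R : (i j k : Leaf L) (l : Leaf R) → i ≢ j
                → QuartetSigned (node L R) a b (inL i) (inL j) (inL k) (inR l)
      outlier-R i j k l i≢j =
        signed-3+1 (triplets-shaped L (a<leftEnd a<b) i j k i≢j) 0<w
                   (apart-LR i l) (apart-LR j l) (apart-LR k l) quartet-LLLR⇔triplet

      outlier-L : (i j k : Leaf R) (l : Leaf L) → i ≢ j
                → QuartetSigned (node L R) a b (inR i) (inR j) (inR k) (inL l)
      outlier-L i j k l i≢j =
        signed-3+1 (triplets-shaped R (rightStart<b a<b) i j k i≢j) 0<w
                   (apart-RL i l) (apart-RL j l) (apart-RL k l) quartet-RRRL⇔triplet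

      quartet-node : QuartetsSigned L a (leftEnd a b) → QuartetsSigned R (rightStart a b) b
                   → QuartetsSigned (node L R) a b
      quartet-node signedL _ (inL i) (inL j) (inL k) (inL l) i≢j k≢l =
        signed-resp refl quartet-inL (signedL i j k l (i≢j ∘ cong inL) (k≢l ∘ cong inL))
      quartet-node _ signedR (inR i) (inR j) (inR k) (inR l) i≢j k≢l =
        signed-resp refl quartet-inR (signedR i j k l (i≢j ∘ cong inR) (k≢l ∘ cong inR))
      quartet-node _ _ (inL i) (inL j) (inR k) (inR l) _ _ = split i j k l
      quartet-node _ _ (inR i) (inR j) (inL k) (inL l) _ _ = QuartetSigned-swap-pairs (split k l i j)
      quartet-node _ _ (inL i) (inR j) (inL k) (inR l) _ _ = crossed i k j l
      quartet-node _ _ (inL i) (inR j) (inR k) (inL l) _ _ = QuartetSigned-swap₃₄ (crossed i l j k)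
      quartet-node _ _ (inR i) (inL j) (inL k) (inR l) _ _ = QuartetSigned-swap₁₂ (crossed j k i l)
      quartet-node _ _ (inR i) (inL j) (inR k) (inL l) _ _ =
        QuartetSigned-swap₁₂ (QuartetSigned-swap₃₄ (crossed j l i k))
      quartet-node _ _ (inL i) (inL j) (inL k) (inR l) i≢j _ = outlier-R i j k l (i≢j ∘ cong inL)
      quartet-node _ _ (inL i) (inL j) (inR k) (inL l) i≢j _ =
        QuartetSigned-swap₃₄ (outlier-R i j l k (i≢j ∘ cong inL))
      quartet-node _ _ (inL i) (inR j) (inL k) (inL l) _ k≢l =
        QuartetSigned-swap-pairs (outlier-R k l i j (k≢l ∘ cong inL))
      quartet-node _ _ (inR i) (inL j) (inL k) (inL l) _ k≢l =
        QuartetSigned-swap-pairs (QuartetSigned-swap₃₄ (outlier-R k l j i (k≢l ∘ cong inL)))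
      quartet-node _ _ (inR i) (inR j) (inR k) (inL l) i≢j _ = outlier-L i j k l (i≢j ∘ cong inR)
      quartet-node _ _ (inR i) (inR j) (inL k) (inR l) i≢j _ =
        QuartetSigned-swap₃₄ (outlier-L i j l k (i≢j ∘ cong inR))
      quartet-node _ _ (inR i) (inL j) (inR k) (inR l) _ k≢l =
        QuartetSigned-swap-pairs (outlier-L k l i j (k≢l ∘ cong inR))
      quartet-node _ _ (inL i) (inR j) (inR k) (inR l) _ k≢l =
        QuartetSigned-swap-pairs (QuartetSigned-swap₃₄ (outlier-L k l j i (k≢l ∘ cong inR)))

    quartets-signed : ∀ t {a b} → a < b → QuartetsSigned t a b
    quartets-signed leaf       _   here here _ _ here≢here _ = contradiction refl here≢here
    quartets-signed (node L R) a<b =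
      quartet-node (quartets-signed L (a<leftEnd a<b)) (quartets-signed R (rightStart<b a<b))
      where open NodeQuartets a<b

lemma10 : (γ : ℚ) → 0ℚ < γ → γ < ½
    → ((γ ^ 2) ⊔ (γ ^ 4)) ⊔ (γ ^ 8) < (1ℚ - (γ + γ)) ^ 8
    → (t : Tree) → (i j k l : Leaf t)
    → i ≢ j → i ≢ k → i ≢ l → j ≢ k → j ≢ l → k ≢ l
    → (QuartetSatisfied i j k l
    → 0ℚ < poly (φ γ t i) (φ γ t j) (φ γ t k) (φ γ t l))
    × (¬ QuartetSatisfied i j k l
    → poly (φ γ t i) (φ γ t j) (φ γ t k) (φ γ t l) < 0ℚ)
lemma10 γ 0<γ γ<½ max<c⁸ t i j k l i≢j _ _ _ _ k≢l =
  quartets-signed γ 0<γ γ<½ γ²<c⁸ γ⁴<c⁸ t (positive⁻¹ 1ℚ) i j k l i≢j k≢l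
  where
  c⁸ : ℚ
  c⁸ = (1ℚ - (γ + γ)) ^ 8
  γ²⊔γ⁴<c⁸ : (γ ^ 2) ⊔ (γ ^ 4) < c⁸
  γ²⊔γ⁴<c⁸ = ≤-<-trans (p≤p⊔q _ (γ ^ 8)) max<c⁸
  γ²<c⁸ : γ ^ 2 < c⁸
  γ²<c⁸ = ≤-<-trans (p≤p⊔q (γ ^ 2) (γ ^ 4)) γ²⊔γ⁴<c⁸
  γ⁴<c⁸ : γ ^ 4 < c⁸
  γ⁴<c⁸ = ≤-<-trans (p≤q⊔p (γ ^ 2) (γ ^ 4)) γ²⊔γ⁴<c⁸
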